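{- Consider the algorithm VertexCut described in the context. In any iteration of its main loop, when a pair $(s,t)\in P$ is selected and $d$ is sampled, if for two nodes $u,v\in V$ we have $d\in[\mathrm{vdist}_{s,t}(s,u),\mathrm{vdist}_{s,t}(s,v))$, then after the nodes are added to $X$ in that iteration, either $u\in X$ or every $u\leadsto v$ path in $G$ contains an internal node (other than $u,v$) in $X$.
   Context: Algorithm VertexCut$(G,L)$, for a directed $n$-node graph $G=(V,E)$ and $L\ge1$. For vertex weights $w$, $\mathrm{vdist}_w(a,b)$ is the minimum over $a\leadsto b$ paths in $G$ of the total weight of interior vertices (excluding $a,b$); unweighted $\mathrm{vdist}_G$ uses weight $1$ on every vertex. Setup: $X\gets\emptyset$; $P\gets\{(s,t)\in V\times V:\mathrm{vdist}_G(s,t)\ge L\}$; $\mathrm{epoch}\gets1$; for each $(s,t)\in P$, $w_{s,t}$ assigns every node weight $1/L$. Define $\mathrm{mass}(\{w_{s,t}\})=\sum_{(s,t)\in P}\sum_{v\in V\setminus X}w_{s,t}(v)$. While $P\ne\emptyset$: (i) for each $(s,t)\in P$, let $w'_{s,t}$ be a minimum fractional $(s,t)$ cut (vertex weights with $\mathrm{vdist}_{w'_{s,t}}(s,t)\ge1$, minimizing total weight) in which all nodes of $X$ have weight $1$ and all nodes of $V\setminus X$ have weight at most $4^{\mathrm{epoch}}/L$; (ii) if $\mathrm{mass}(\{w_{s,t}\})>\log n\cdot\mathrm{mass}(\{w'_{s,t}\})$, then increment $\mathrm{epoch}$ and set $w_{s,t}\gets w'_{s,t}$ for all pairs; (iii)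 remove a uniformly random pair $(s,t)$ from $P$, sample $d$ uniformly from $[0,1]$, and add to $X$ every node $v$ with $d\in[\mathrm{vdist}_{s,t}(s,v),\ \mathrm{vdist}_{s,t}(s,v)+w_{s,t}(v)]$, where $\mathrm{vdist}_{s,t}$ denotes $\mathrm{vdist}_{w_{s,t}}$. Return $X$.
   Formalization: The vertex weights $w_{s,t}$ and the sampled value $d$ take rational values. -}

module Defs where

open import Data.Nat using (ℕ)
open import Data.Fin using (Fin)
open import Data.List using (List; []; _∷_; foldr)
open import Data.List.Relation.Unary.Any using (Any)
open import Data.Rational using (ℚ; _+_; _≤_; _<_; 0ℚ; 1ℚ)
open import Data.Product using (Σ; _×_; ∃)
open import Data.Sum using (_⊎_)
open import Data.Empty using (⊥)
open import Data.Unit using (⊤)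
open import Relation.Binary.PropositionalEquality using (_≡_)

record Digraph (n : ℕ) : Set₁ where
  field
    Edge : Fin n → Fin n → Set

-- Walk G a b is : an a ⇝ b walk in G whose list of interior vertices
-- (all vertices strictly between the two endpoints, in order) is `is`.
-- `triv` is the trivial (length-0) walk from a to a.
data Walk {n : ℕ} (G : Digraph n) : Fin n → Fin n → List (Fin n) → Set where
  triv : ∀ {a} → Walk G a a []
  edge : ∀ {a b} → Digraph.Edge G a b → Walk G a b []
  step : ∀ {a b c is} → Digraph.Edge G a b → Walk G b c is → Walk G a c (b ∷ is)

weightOf : ∀ {n} → (Fin n → ℚ) → List (Fin n) → ℚ
weightOf w is = foldr (λ x acc → w x + acc) 0ℚ is

data ℚ∞ : Set where
  fin : ℚ → ℚ∞
  ∞   : ℚ∞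

_≤∞_ : ℚ∞ → ℚ∞ → Set
fin x ≤∞ fin y = x ≤ y
fin x ≤∞ ∞     = ⊤
∞     ≤∞ fin y = ⊥
∞     ≤∞ ∞     = ⊤

_<∞_ : ℚ∞ → ℚ∞ → Set
fin x <∞ fin y = x < y
fin x <∞ ∞     = ⊤
∞     <∞ _     = ⊥

-- IsVDist G w a b D : D = vdist_w(a,b), the minimum over a ⇝ b walks of
-- the total weight of interior vertices (∞ if no a ⇝ b walk exists).
IsVDist : ∀ {n} → Digraph n → (Fin n → ℚ) → Fin n → Fin n → ℚ∞ → Set
IsVDist G w a b (fin D) =
  (Σ (List _) λ is → Walk G a b is × weightOf w is ≡ D) ×
  (∀ is → Walk G a b is → D ≤ weightOf w is)
IsVDist G w a b ∞ = ∀ is → Walk G a b is → ⊥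

-- Nodes added to X in step (iii): v with d ∈ [vdist(s,v), vdist(s,v)+w(v)],
-- where dist v = vdist_w(s,v).
Added : ∀ {n} → (Fin n → ℚ) → (Fin n → ℚ∞) → ℚ → Fin n → Set
Added w dist d v = Σ ℚ λ D → dist v ≡ fin D × D ≤ d × d ≤ D + w v

XAfter : ∀ {n} → (Fin n → Set) → (Fin n → ℚ) → (Fin n → ℚ∞) → ℚ → Fin n → Set
XAfter X w dist d v = X v ⊎ Added w dist d v

-- Follow a u ⇝ v walk from u while d lies strictly beyond the interval
-- [vdist(s,c), vdist(s,c) + w(c)] of the current node c.  Then the next node b
-- satisfies vdist(s,b) ≤ vdist(s,c) + w(c) < d, so either d falls into the
-- interval of b (and b is added to X) or the walk continues beyond b.  The walk
-- cannot reach v this way, since d < vdist(s,v).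
module Submission where

open import Defs
open import Data.Nat using (ℕ)
open import Data.Fin using (Fin)
open import Data.List using (List; []; _∷_)
open import Data.List.Relation.Unary.Any as Any using (Any; here; there)
open import Data.Rational using (ℚ; _≤_; _<_; _+_; 0ℚ; 1ℚ)
open import Data.Rational.Properties
open import Data.Sum using (_⊎_; inj₁; inj₂)
open import Data.Product using (Σ; _×_; _,_)
open import Data.Empty using (⊥; ⊥-elim)
open import Relation.Nullary using (yes; no)
open import Relation.Binary.PropositionalEquality using (refl; sym; subst)

≤∞-fin-trans : ∀ {x a b} → x ≤∞ fin a → a ≤ b → x ≤∞ fin b
≤∞-fin-trans {fin x} x≤a a≤b = ≤-trans x≤a a≤b

<∞⇒≱∞ : ∀ {a x} → fin a <∞ x → x ≤∞ fin a → ⊥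
<∞⇒≱∞ {x = fin x} a<x x≤a = <-irrefl refl (<-≤-trans a<x x≤a)

module _ {n : ℕ} (G : Digraph n) (w : Fin n → ℚ) (w≥0 : ∀ v → 0ℚ ≤ w v) where

  x≤x+w : ∀ x c → x ≤ x + w c
  x≤x+w x c = subst (_≤ x + w c) (+-identityʳ x) (+-monoʳ-≤ x (w≥0 c))

  vdist-≤-walk : ∀ {a b is D} → IsVDist G w a b D → Walk G a b is → D ≤∞ fin (weightOf w is)
  vdist-≤-walk {D = fin D} (_ , minimal) walk = minimal _ walk
  vdist-≤-walk {D = ∞}     noWalk        walk = noWalk _ walk

  -- Appending an edge adds the old endpoint c as an interior node, except
  -- when the walk is trivial (c = a), which is why only ≤ holds.
  Walk-snoc : ∀ {a b c js} → Walk G a c js → Digraph.Edge G c b →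
              Σ (List (Fin n)) λ is → Walk G a b is × weightOf w is ≤ weightOf w js + w c
  Walk-snoc {c = c} triv        e = [] , edge e , x≤x+w 0ℚ c
  Walk-snoc {c = c} (edge e′)   e = c ∷ [] , step e′ (edge e) , ≤-reflexive (+-comm (w c) 0ℚ)
  Walk-snoc {c = c} (step {b = x} {is = js} e′ r) e with Walk-snoc r e
  ... | is , walk , le = x ∷ is , step e′ walk ,
        ≤-trans (+-monoʳ-≤ (w x) le) (≤-reflexive (sym (+-assoc (w x) (weightOf w js) (w c))))

  module _ (s : Fin n) (dist : Fin n → ℚ∞) (isVDist : ∀ v → IsVDist G w s v (dist v))
           (d : ℚ) where

    Passed : Fin n → Set
    Passed c = Σ (List (Fin n)) λ js → Walk G s c js × weightOf w js + w c < d

    passed⇒dist≤ : ∀ {c} → Passed c → dist c ≤∞ fin d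
    passed⇒dist≤ {c} (js , walk , lt) =
      ≤∞-fin-trans (vdist-≤-walk (isVDist c) walk) (≤-trans (x≤x+w _ c) (<⇒≤ lt))

    passed-edge⇒dist≤ : ∀ {c b} → Passed c → Digraph.Edge G c b → dist b ≤∞ fin d
    passed-edge⇒dist≤ {b = b} (js , walk , lt) e with Walk-snoc walk e
    ... | is , walk′ , le = ≤∞-fin-trans (vdist-≤-walk (isVDist b) walk′) (≤-trans le (<⇒≤ lt))

    added-or-passed : ∀ b → dist b ≤∞ fin d → Added w dist d b ⊎ Passed b
    added-or-passed b b≤d with dist b in eq | isVDist b
    ... | fin D | (js , walk , weight≡D) , _ with d ≤? D + w b
    ...   | yes d≤ = inj₁ (D , refl , b≤d , d≤)
    ...   | no  d≰ = inj₂ (js , walk , subst (λ x → x + w b < d) (sym weight≡D) (≰⇒> d≰))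

    passed-walk-hits-Added : ∀ {c v is} → fin d <∞ dist v → Passed c → Walk G c v is →
                             Any (Added w dist d) is
    passed-walk-hits-Added v>d pc triv       = ⊥-elim (<∞⇒≱∞ v>d (passed⇒dist≤ pc))
    passed-walk-hits-Added v>d pc (edge e)   = ⊥-elim (<∞⇒≱∞ v>d (passed-edge⇒dist≤ pc e))
    passed-walk-hits-Added {is = b ∷ _} v>d pc (step e r)
      with added-or-passed b (passed-edge⇒dist≤ pc e)
    ... | inj₁ added = here added
    ... | inj₂ pb    = there (passed-walk-hits-Added v>d pb r)

lemma3 : (n : ℕ) (G : Digraph n) (X : Fin n → Set) (w : Fin n → ℚ)
    → (∀ v → 0ℚ ≤ w v)
    → (s : Fin n) (dist : Fin n → ℚ∞)
    → (∀ v → IsVDist G w s v (dist v))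
    → (d : ℚ) → 0ℚ ≤ d → d ≤ 1ℚ
    → (u v : Fin n)
    → dist u ≤∞ fin d → fin d <∞ dist v
    → XAfter X w dist d u
    ⊎ (∀ is → Walk G u v is → Any (XAfter X w dist d) is)
lemma3 n G X w w≥0 s dist isVDist d _ _ u v u≤d v>d
  with added-or-passed G w w≥0 s dist isVDist d u u≤d
... | inj₁ added = inj₁ (inj₂ added)
... | inj₂ pu    = inj₂ λ is walk →
        Any.map inj₂ (passed-walk-hits-Added G w w≥0 s dist isVDist d v>d pu walk)
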